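{- Let $B=F(b_1,\ldots,b_n)$ be a Ferrers board with $0\le b_1\le\cdots\le b_n$ and $b_n>0$, and let $x$ be a positive integer. Then $$[x]_q^n=\sum_{k=0}^n\overline{\mathbf{RT}}_{n-k}(B,q)\,([x]_q-[F_{b_1}]_q)([x]_q-[F_{b_2}]_q)\cdots([x]_q-[F_{b_k}]_q).$$
   Context: Fibonacci numbers: $F_0=0$, $F_1=1$, $F_m=F_{m-1}+F_{m-2}$. For an integer $m$, $[m]_q=\frac{1-q^m}{1-q}$ (so $[0]_q=0$). For $m\ge1$, $\mathcal{F}_m$ is the set of tilings of a column of height $m$ (levels $1,\dots,m$ from the bottom) by tiles of heights 1 and 2 whose bottom-most tile has height 1; $\mathcal{F}_0=\emptyset$. For $T\in\mathcal{F}_m$, $\mathrm{rank}_m(T)=\sum F_{i-1}$, the sum over all $i$ such that $T$ has a tile of height 2 occupying levels $i-1$ and $i$. A Ferrers board $F(b_1,\dots,b_n)$ has columns $1,\dots,n$ of heights $b_1\le\cdots\le b_n$. For $0\le k\le n$, $\mathcal{NT}_k(B)$ is the set of Fibonacci rook placements with $k$ tilings: a sequence of columns $1\le i_1<\cdots<i_k\le n$ together with, for each $s=1,\dots,k$, a tiling $T_{i_s}\in\mathcal{F}_{e_s}$ where $e_s=b_{i_s-s+1}$ (geometrically, each tiling cancels top cells of the columns to its right so that after $s$ tilings the untiled columns have $b_1,\dots,b_{n-s}$ uncanceled cells from left to right, and the tiling in column $i_s$ fills its $b_{i_s-s+1}$ uncanceled cells). For $k=0$ only the empty placement exists. For such $P$,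 $\overline{W}_{B,q}(P)=q^{\sum_{s=1}^k\mathrm{rank}_{e_s}(T_{i_s})}$ and $\overline{\mathbf{RT}}_k(B,q)=\sum_{P\in\mathcal{NT}_k(B)}\overline{W}_{B,q}(P)$. An empty product equals 1. -}

module Defs where

open import Level using (Level)
open import Data.Nat using (ℕ; zero; suc; _+_; _∸_; _≤_; _<_)
open import Data.Product using (_×_; _,_; proj₁; proj₂)
open import Data.List using (List; []; _∷_; map; concatMap; foldr; upTo)
open import Data.Nat.ListAction using (sum)
open import Data.Vec using (Vec; toList; lookup)
open import Data.Fin using (Fin)
import Data.Fin as Fin
open import Algebra.Bundles using (CommutativeRing)

fib : ℕ → ℕ
fib zero = 0
fib (suc zero) = 1
fib (suc (suc m)) = fib (suc m) + fib m

-- Tiles of height 1 and 2; a tiling is the list of its tiles from the bottom up.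
data Tile : Set where
  one two : Tile

Tiling : Set
Tiling = List Tile

allTilings : ℕ → List Tiling
allTilings zero = [] ∷ []
allTilings (suc zero) = (one ∷ []) ∷ []
allTilings (suc (suc m)) =
  map (one ∷_) (allTilings (suc m)) Data.List.++ map (two ∷_) (allTilings m)

fibTilings : ℕ → List Tiling
fibTilings zero = []
fibTilings (suc m) = map (one ∷_) (allTilings m)

-- rankAux ℓ T: ℓ is the level of the bottom of the first tile of T.
-- A height-2 tile on levels ℓ, ℓ+1 (i.e. i-1 = ℓ, i = ℓ+1) contributes F_{i-1} = F_ℓ.
rankAux : ℕ → Tiling → ℕ
rankAux ℓ [] = 0
rankAux ℓ (one ∷ t) = rankAux (suc ℓ) t
rankAux ℓ (two ∷ t) = fib ℓ + rankAux (suc (suc ℓ)) t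

rank : Tiling → ℕ
rank T = rankAux 1 T

-- 1-based access to the column heights b_1 … b_n (0 outside the range)
col : List ℕ → ℕ → ℕ
col [] _ = 0
col (b ∷ bs) zero = 0
col (b ∷ bs) (suc zero) = b
col (b ∷ bs) (suc (suc i)) = col bs (suc i)

choose : ℕ → List ℕ → List (List ℕ)
choose zero _ = [] ∷ []
choose (suc k) [] = []
choose (suc k) (i ∷ is) = map (i ∷_) (choose k is) Data.List.++ choose (suc k) is

columns : ℕ → List ℕ
columns n = map suc (upTo n)

-- A Fibonacci rook placement: the list of pairs (i_s , T_{i_s}), s = 1, …, k.
Placement : Set
Placement = List (ℕ × Tiling)

-- placements on a given increasing column sequence; s is the index of the
-- first column of the sequence; T_{i_s} ∈ 𝓕_{e_s}, e_s = b_{i_s - s + 1}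
placementsOn : List ℕ → ℕ → List ℕ → List Placement
placementsOn b s [] = [] ∷ []
placementsOn b s (i ∷ is) =
  concatMap (λ T → map ((i , T) ∷_) (placementsOn b (suc s) is))
            (fibTilings (col b (i ∸ s + 1)))

NT : {n : ℕ} → ℕ → Vec ℕ n → List Placement
NT {n} k b = concatMap (placementsOn (toList b) 1) (choose k (columns n))

placementRank : Placement → ℕ
placementRank P = sum (map (λ p → rank (proj₂ p)) P)

Nondecreasing : {n : ℕ} → Vec ℕ n → Set
Nondecreasing {n} b = ∀ (i j : Fin n) → i Fin.≤ j → lookup b i ≤ lookup b j

-- Ring-valued quantities (q is an element of an arbitrary commutative ring,
-- which is equivalent to an identity in ℤ[q]).
module _ {c ℓ : Level} (R : CommutativeRing c ℓ) where
  open CommutativeRing R using (Carrier; 0#; 1#) renaming (_+_ to _⊕_; _*_ to _⊛_; _-_ to _⊖_)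

  pow : Carrier → ℕ → Carrier
  pow q zero = 1#
  pow q (suc m) = q ⊛ pow q m

  qInt : Carrier → ℕ → Carrier
  qInt q zero = 0#
  qInt q (suc m) = 1# ⊕ q ⊛ qInt q m

  ringSum : List Carrier → Carrier
  ringSum = foldr _⊕_ 0#

  RT : {n : ℕ} → ℕ → Vec ℕ n → Carrier → Carrier
  RT k b q = ringSum (map (λ P → pow q (placementRank P)) (NT k b))

  fallingProd : {n : ℕ} → ℕ → Vec ℕ n → ℕ → Carrier → Carrier
  fallingProd zero b x q = 1#
  fallingProd (suc k) b x q =
    fallingProd k b x q ⊛ (qInt q x ⊖ qInt q (fib (col (toList b) (suc k))))

  rhs : {n : ℕ} → Vec ℕ n → ℕ → Carrier → Carrier
  rhs {n} b x q =
    ringSum (map (λ k → RT (n ∸ k) b q ⊛ fallingProd k b x q) (upTo (suc n)))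

-- The rank generating function of 𝓕_e is [F_e]_q: removing the top tile gives
-- [F_{e+2}]_q = [F_{e+1}]_q + q^{F_{e+1}} [F_e]_q. A placement of j tilings on B is a choice of j
-- columns in which the s-th tiling, put in column i, carries the weight y_{i-s+1} = [F_{b_{i-s+1}}]_q,
-- so RT_j(B) is the complete homogeneous polynomial h_j(y_1, …, y_{n-j+1}). The theorem is then the
-- Newton interpolation identity X^n = Σ_{j+k=n} h_j(y_1, …, y_{k+1}) (X - y_1) ⋯ (X - y_k), whose
-- inductive step multiplies by X = (X - y_{k+1}) + y_{k+1} and regroups with the Pascal rule
-- h_{j+1}(y_1, …, y_{r+1}) = h_{j+1}(y_1, …, y_r) + y_{r+1} h_j(y_1, …, y_{r+1}).
module Submission where

open import Defs
open import Level using (Level)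
open import Data.Nat using (ℕ; zero; suc; _∸_; _<_; s≤s)
import Data.Nat as ℕ
import Data.Nat.Properties as ℕₚ
open import Data.List using (List; []; _∷_; _++_; map; concatMap; length; upTo; applyUpTo)
open import Data.List.Properties using (map-++; map-∘; map-applyUpTo; map-upTo; length-applyUpTo)
open import Data.Product using (_,_)
open import Data.Vec using (Vec; toList)
open import Function using (_∘_)
open import Algebra.Bundles using (CommutativeRing)
open import Relation.Binary.PropositionalEquality using (_≡_; cong; cong₂)
import Relation.Binary.PropositionalEquality as ≡

length<⇒choose≡[] : ∀ {k} (xs : List ℕ) → length xs < k → choose k xs ≡ []
length<⇒choose≡[] {suc k} []       _          = ≡.refl
length<⇒choose≡[] {suc k} (x ∷ xs) (s≤s |xs|<k)
  rewrite length<⇒choose≡[] xs |xs|<k | length<⇒choose≡[] xs (ℕₚ.m<n⇒m<1+n |xs|<k) = ≡.refl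

private
  variable
    A B : Set

module _ {r ℓ : Level} (R : CommutativeRing r ℓ) where
  open CommutativeRing R
  open import Relation.Binary.Reasoning.Setoid setoid
  open import Algebra.Solver.Ring.NaturalCoefficients.Default commutativeSemiring

  Σ : List Carrier → Carrier
  Σ = ringSum R

  Σ-++ : ∀ xs ys → Σ (xs ++ ys) ≈ Σ xs + Σ ys
  Σ-++ []       ys = sym (+-identityˡ _)
  Σ-++ (x ∷ xs) ys = trans (+-congˡ (Σ-++ xs ys)) (sym (+-assoc _ _ _))

  Σ-map-cong : ∀ {f g : A → Carrier} → (∀ a → f a ≈ g a) → ∀ xs → Σ (map f xs) ≈ Σ (map g xs)
  Σ-map-cong f≈g []       = refl
  Σ-map-cong f≈g (x ∷ xs) = +-cong (f≈g x) (Σ-map-cong f≈g xs)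

  Σ-map-++ : ∀ (f : A → Carrier) xs ys → Σ (map f (xs ++ ys)) ≈ Σ (map f xs) + Σ (map f ys)
  Σ-map-++ f xs ys = trans (reflexive (cong Σ (map-++ f xs ys))) (Σ-++ (map f xs) (map f ys))

  Σ-map-*ˡ : ∀ x (f : A → Carrier) xs → Σ (map (λ a → x * f a) xs) ≈ x * Σ (map f xs)
  Σ-map-*ˡ x f []       = sym (zeroʳ x)
  Σ-map-*ˡ x f (a ∷ xs) = trans (+-congˡ (Σ-map-*ˡ x f xs)) (sym (distribˡ x _ _))

  Σ-map-*ʳ : ∀ x (f : A → Carrier) xs → Σ (map (λ a → f a * x) xs) ≈ Σ (map f xs) * x
  Σ-map-*ʳ x f []       = sym (zeroˡ x)
  Σ-map-*ʳ x f (a ∷ xs) = trans (+-congˡ (Σ-map-*ʳ x f xs)) (sym (distribʳ x _ _))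

  Σ-map-concatMap : ∀ (f : B → Carrier) (g : A → List B) xs →
    Σ (map f (concatMap g xs)) ≈ Σ (map (λ a → Σ (map f (g a))) xs)
  Σ-map-concatMap f g []       = refl
  Σ-map-concatMap f g (a ∷ xs) =
    trans (Σ-map-++ f (g a) (concatMap g xs)) (+-congˡ (Σ-map-concatMap f g xs))

  qInt-1 : ∀ x → 1# + 0# ≈ qInt R x 1
  qInt-1 x = +-congˡ (sym (zeroʳ x))

  pow-+ : ∀ x m n → pow R x (m ℕ.+ n) ≈ pow R x m * pow R x n
  pow-+ x zero    n = sym (*-identityˡ _)
  pow-+ x (suc m) n = trans (*-congˡ (pow-+ x m n)) (sym (*-assoc _ _ _))

  qInt-+ : ∀ x m n → qInt R x (m ℕ.+ n) ≈ qInt R x m + pow R x m * qInt R x n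
  qInt-+ x zero    n = sym (trans (+-congˡ (*-identityˡ _)) (+-identityˡ _))
  qInt-+ x (suc m) n = begin
    1# + x * qInt R x (m ℕ.+ n)
      ≈⟨ +-congˡ (*-congˡ (qInt-+ x m n)) ⟩
    1# + x * (qInt R x m + pow R x m * qInt R x n)
      ≈⟨ solve 5 (λ o x u v w → o :+ x :* (u :+ v :* w) := (o :+ x :* u) :+ (x :* v) :* w)
           refl 1# x (qInt R x m) (pow R x m) (qInt R x n) ⟩
    (1# + x * qInt R x m) + (x * pow R x m) * qInt R x n ∎

  antidiagonalSum : (ℕ → ℕ → Carrier) → ℕ → Carrier
  antidiagonalSum g zero    = g 0 0
  antidiagonalSum g (suc n) = g (suc n) 0 + antidiagonalSum (λ j k → g j (suc k)) n

  antidiagonalSum-cong : ∀ {g h : ℕ → ℕ → Carrier} n → (∀ j k → j ℕ.+ k ≡ n → g j k ≈ h j k) →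
    antidiagonalSum g n ≈ antidiagonalSum h n
  antidiagonalSum-cong zero    g≈h = g≈h 0 0 ≡.refl
  antidiagonalSum-cong (suc n) g≈h = +-cong (g≈h (suc n) 0 (ℕₚ.+-identityʳ (suc n)))
    (antidiagonalSum-cong n (λ j k j+k≡n → g≈h j (suc k) (≡.trans (ℕₚ.+-suc j k) (cong suc j+k≡n))))

  antidiagonalSum-+ : ∀ (g h : ℕ → ℕ → Carrier) n →
    antidiagonalSum (λ j k → g j k + h j k) n ≈ antidiagonalSum g n + antidiagonalSum h n
  antidiagonalSum-+ g h zero    = refl
  antidiagonalSum-+ g h (suc n) = begin
    (g (suc n) 0 + h (suc n) 0) + antidiagonalSum (λ j k → g j (suc k) + h j (suc k)) n
      ≈⟨ +-congˡ (antidiagonalSum-+ (λ j k → g j (suc k)) (λ j k → h j (suc k)) n) ⟩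
    (g (suc n) 0 + h (suc n) 0) + (G + H)
      ≈⟨ solve 4 (λ a b G H → (a :+ b) :+ (G :+ H) := (a :+ G) :+ (b :+ H)) refl (g (suc n) 0) (h (suc n) 0) G H ⟩
    (g (suc n) 0 + G) + (h (suc n) 0 + H) ∎
    where
    G = antidiagonalSum (λ j k → g j (suc k)) n
    H = antidiagonalSum (λ j k → h j (suc k)) n

  antidiagonalSum-*ˡ : ∀ x (g : ℕ → ℕ → Carrier) n →
    antidiagonalSum (λ j k → x * g j k) n ≈ x * antidiagonalSum g n
  antidiagonalSum-*ˡ x g zero    = refl
  antidiagonalSum-*ˡ x g (suc n) =
    trans (+-congˡ (antidiagonalSum-*ˡ x (λ j k → g j (suc k)) n)) (sym (distribˡ x _ _))

  antidiagonalSum-suc : ∀ (g : ℕ → ℕ → Carrier) n →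
    antidiagonalSum g (suc n) ≈ antidiagonalSum (λ j k → g (suc j) k) n + g 0 (suc n)
  antidiagonalSum-suc g zero    = refl
  antidiagonalSum-suc g (suc n) =
    trans (+-congˡ (antidiagonalSum-suc (λ j k → g j (suc k)) n)) (sym (+-assoc _ _ _))

  Σ-upTo≈antidiagonalSum : ∀ (g : ℕ → ℕ → Carrier) n →
    Σ (map (λ k → g (n ∸ k) k) (upTo (suc n))) ≈ antidiagonalSum g n
  Σ-upTo≈antidiagonalSum g zero    = +-identityʳ _
  Σ-upTo≈antidiagonalSum g (suc n) = +-congˡ (begin
    Σ (map (λ k → g (suc n ∸ k) k) (applyUpTo suc (suc n)))
      ≡⟨ cong Σ (≡.trans (map-applyUpTo suc _ (suc n)) (≡.sym (map-upTo _ (suc n)))) ⟩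
    Σ (map (λ k → g (n ∸ k) (suc k)) (upTo (suc n)))
      ≈⟨ Σ-upTo≈antidiagonalSum (λ j k → g j (suc k)) n ⟩
    antidiagonalSum (λ j k → g j (suc k)) n ∎)

  -- h_j(z 0, …, z (r-1)), the complete homogeneous symmetric polynomial in r variables
  completeHomogeneous : (ℕ → Carrier) → ℕ → ℕ → Carrier
  completeHomogeneous z zero    r       = 1#
  completeHomogeneous z (suc j) zero    = 0#
  completeHomogeneous z (suc j) (suc r) =
    z 0 * completeHomogeneous z j (suc r) + completeHomogeneous (z ∘ suc) (suc j) r

  completeHomogeneous-last : ∀ z j r →
    completeHomogeneous z (suc j) (suc r) ≈ completeHomogeneous z (suc j) r + z r * completeHomogeneous z j (suc r)
  completeHomogeneous-last z j       zero    = +-comm _ _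
  completeHomogeneous-last z zero    (suc r) = begin
    z 0 * 1# + h (z ∘ suc) 1 (suc r)             ≈⟨ +-congˡ (completeHomogeneous-last (z ∘ suc) 0 r) ⟩
    z 0 * 1# + (h (z ∘ suc) 1 r + z (suc r) * 1#) ≈⟨ sym (+-assoc _ _ _) ⟩
    (z 0 * 1# + h (z ∘ suc) 1 r) + z (suc r) * 1# ∎
    where h = completeHomogeneous
  completeHomogeneous-last z (suc j) (suc r) = begin
    z 0 * h z (suc j) (suc (suc r)) + h (z ∘ suc) (suc (suc j)) (suc r)
      ≈⟨ +-cong (*-congˡ (completeHomogeneous-last z j (suc r))) (completeHomogeneous-last (z ∘ suc) (suc j) r) ⟩
    z 0 * (a + z (suc r) * b) + (c + z (suc r) * d)
      ≈⟨ solve 6 (λ z₀ y a b c d → z₀ :* (a :+ y :* b) :+ (c :+ y :* d) := (z₀ :* a :+ c) :+ y :* (z₀ :* b :+ d))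
           refl (z 0) (z (suc r)) a b c d ⟩
    (z 0 * a + c) + z (suc r) * (z 0 * b + d) ∎
    where
    h = completeHomogeneous
    a = h z (suc j) (suc r)
    b = h z j (suc (suc r))
    c = h (z ∘ suc) (suc (suc j)) r
    d = h (z ∘ suc) (suc j) (suc r)

  newtonBasis : Carrier → (ℕ → Carrier) → ℕ → Carrier
  newtonBasis X z zero    = 1#
  newtonBasis X z (suc k) = newtonBasis X z k * (X - z k)

  *-newtonBasis : ∀ X z k → X * newtonBasis X z k ≈ newtonBasis X z (suc k) + z k * newtonBasis X z k
  *-newtonBasis X z k = sym (begin
    P * (X - z k) + z k * P
      ≈⟨ solve 4 (λ P X u y → P :* (X :+ u) :+ y :* P := X :* P :+ P :* (u :+ y)) refl P X (- z k) (z k) ⟩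
    X * P + P * (- z k + z k) ≈⟨ +-congˡ (*-congˡ (-‿inverseˡ (z k))) ⟩
    X * P + P * 0#            ≈⟨ +-congˡ (zeroʳ P) ⟩
    X * P + 0#                ≈⟨ +-identityʳ _ ⟩
    X * P                     ∎)
    where P = newtonBasis X z k

  -- The Pascal rule completeHomogeneous-last, summed along an antidiagonal against arbitrary P.
  completeHomogeneous-antidiagonal : ∀ z (P : ℕ → Carrier) m →
    antidiagonalSum (λ j k → completeHomogeneous z j (2 ℕ.+ k) * P (suc k)) m + z 0 * (completeHomogeneous z m 1 * P 0) ≈
    antidiagonalSum (λ j k → completeHomogeneous z j (suc k) * P (suc k)) m +
    antidiagonalSum (λ j k → z k * (completeHomogeneous z j (suc k) * P k)) m
  completeHomogeneous-antidiagonal z P zero    = refl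
  completeHomogeneous-antidiagonal z P (suc m) = begin
    antidiagonalSum (λ j k → c j (suc k) * P (suc k)) (suc m) + Z
      ≈⟨ +-congʳ (antidiagonalSum-suc (λ j k → c j (suc k) * P (suc k)) m) ⟩
    (antidiagonalSum (λ j k → c (suc j) (suc k) * P (suc k)) m + T) + Z
      ≈⟨ +-congʳ (+-congʳ (trans (antidiagonalSum-cong m (λ j k _ → pascal j k)) (antidiagonalSum-+ _ _ m))) ⟩
    ((B₁ + B₂) + T) + Z
      ≈⟨ solve 4 (λ b₁ b₂ t z → ((b₁ :+ b₂) :+ t) :+ z := (b₁ :+ t) :+ (z :+ b₂)) refl B₁ B₂ T Z ⟩
    (B₁ + T) + (Z + B₂)
      ≈⟨ +-congʳ (sym (antidiagonalSum-suc (λ j k → c j k * P (suc k)) m)) ⟩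
    antidiagonalSum (λ j k → c j k * P (suc k)) (suc m) + (Z + B₂) ∎
    where
    c : ℕ → ℕ → Carrier
    c j k = completeHomogeneous z j (suc k)
    Z = z 0 * (c (suc m) 0 * P 0)
    T = 1# * P (suc (suc m))
    B₁ = antidiagonalSum (λ j k → c (suc j) k * P (suc k)) m
    B₂ = antidiagonalSum (λ j k → z (suc k) * (c j (suc k) * P (suc k))) m
    pascal : ∀ j k → c (suc j) (suc k) * P (suc k) ≈ c (suc j) k * P (suc k) + z (suc k) * (c j (suc k) * P (suc k))
    pascal j k = trans (*-congʳ (completeHomogeneous-last z j (suc k))) (trans (distribʳ _ _ _) (+-congˡ (*-assoc _ _ _)))

  newtonSum : Carrier → (ℕ → Carrier) → ℕ → Carrier
  newtonSum X z = antidiagonalSum (λ j k → completeHomogeneous z j (suc k) * newtonBasis X z k)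

  newtonSum-suc : ∀ X z n → newtonSum X z (suc n) ≈ X * newtonSum X z n
  newtonSum-suc X z n = begin
    newtonSum X z (suc n)
      ≈⟨ +-congʳ (*-congʳ (completeHomogeneous-last z n 0)) ⟩
    (0# + z 0 * c n 0) * P 0 + D
      ≈⟨ solve 4 (λ z₀ c P₀ d → (con 0 :+ z₀ :* c) :* P₀ :+ d := d :+ z₀ :* (c :* P₀))
           refl (z 0) (c n 0) (P 0) D ⟩
    D + z 0 * (c n 0 * P 0)
      ≈⟨ completeHomogeneous-antidiagonal z P n ⟩
    antidiagonalSum (λ j k → c j k * P (suc k)) n + antidiagonalSum (λ j k → z k * (c j k * P k)) n
      ≈⟨ sym (antidiagonalSum-+ (λ j k → c j k * P (suc k)) (λ j k → z k * (c j k * P k)) n) ⟩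
    antidiagonalSum (λ j k → c j k * P (suc k) + z k * (c j k * P k)) n
      ≈⟨ antidiagonalSum-cong n (λ j k _ → expand j k) ⟩
    antidiagonalSum (λ j k → X * (c j k * P k)) n
      ≈⟨ antidiagonalSum-*ˡ X (λ j k → c j k * P k) n ⟩
    X * newtonSum X z n ∎
    where
    c : ℕ → ℕ → Carrier
    c j k = completeHomogeneous z j (suc k)
    P = newtonBasis X z
    D = antidiagonalSum (λ j k → c j (suc k) * P (suc k)) n
    expand : ∀ j k → c j k * P (suc k) + z k * (c j k * P k) ≈ X * (c j k * P k)
    expand j k = begin
      c j k * P (suc k) + z k * (c j k * P k)
        ≈⟨ solve 4 (λ c P' y P → c :* P' :+ y :* (c :* P) := c :* (P' :+ y :* P)) refl (c j k) (P (suc k)) (z k) (P k) ⟩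
      c j k * (P (suc k) + z k * P k)
        ≈⟨ *-congˡ (sym (*-newtonBasis X z k)) ⟩
      c j k * (X * P k)
        ≈⟨ solve 3 (λ c X P → c :* (X :* P) := X :* (c :* P)) refl (c j k) X (P k) ⟩
      X * (c j k * P k) ∎

  newtonSum≈pow : ∀ X z n → newtonSum X z n ≈ pow R X n
  newtonSum≈pow X z zero    = *-identityˡ 1#
  newtonSum≈pow X z (suc n) = trans (newtonSum-suc X z n) (*-congˡ (newtonSum≈pow X z n))

  module _ (q : Carrier) where

    tilingSumFrom : ℕ → ℕ → Carrier
    tilingSumFrom ℓ m = Σ (map (pow R q ∘ rankAux ℓ) (allTilings m))

    tilingSumFrom-bottom : ∀ ℓ m → tilingSumFrom ℓ (suc (suc m)) ≈
      tilingSumFrom (suc ℓ) (suc m) + pow R q (fib ℓ) * tilingSumFrom (suc (suc ℓ)) m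
    tilingSumFrom-bottom ℓ m = begin
      tilingSumFrom ℓ (suc (suc m))
        ≈⟨ Σ-map-++ w (map (one ∷_) (allTilings (suc m))) (map (two ∷_) (allTilings m)) ⟩
      Σ (map w (map (one ∷_) (allTilings (suc m)))) + Σ (map w (map (two ∷_) (allTilings m)))
        ≡⟨ cong₂ _+_ (cong Σ (≡.sym (map-∘ (allTilings (suc m))))) (cong Σ (≡.sym (map-∘ (allTilings m)))) ⟩
      tilingSumFrom (suc ℓ) (suc m) + Σ (map (λ T → pow R q (fib ℓ ℕ.+ rankAux (suc (suc ℓ)) T)) (allTilings m))
        ≈⟨ +-congˡ (Σ-map-cong (λ T → pow-+ q (fib ℓ) _) (allTilings m)) ⟩
      tilingSumFrom (suc ℓ) (suc m) + Σ (map (λ T → pow R q (fib ℓ) * pow R q (rankAux (suc (suc ℓ)) T)) (allTilings m))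
        ≈⟨ +-congˡ (Σ-map-*ˡ (pow R q (fib ℓ)) _ (allTilings m)) ⟩
      tilingSumFrom (suc ℓ) (suc m) + pow R q (fib ℓ) * tilingSumFrom (suc (suc ℓ)) m ∎
      where w = pow R q ∘ rankAux ℓ

    powFib-cong : ∀ {m n} → m ≡ n → pow R q (fib m) ≈ pow R q (fib n)
    powFib-cong = reflexive ∘ cong (pow R q ∘ fib)

    tilingSumFrom-top : ∀ ℓ m → tilingSumFrom ℓ (suc (suc m)) ≈
      tilingSumFrom ℓ (suc m) + pow R q (fib (ℓ ℕ.+ m)) * tilingSumFrom ℓ m
    tilingSumFrom-top ℓ zero =
      trans (tilingSumFrom-bottom ℓ 0) (+-congˡ (*-congʳ (powFib-cong (≡.sym (ℕₚ.+-identityʳ ℓ)))))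
    tilingSumFrom-top ℓ (suc m) = begin
      S ℓ (3 ℕ.+ m)
        ≈⟨ tilingSumFrom-bottom ℓ (suc m) ⟩
      S (suc ℓ) (2 ℕ.+ m) + a * S (2 ℕ.+ ℓ) (suc m)
        ≈⟨ +-congʳ (tilingSumFrom-top (suc ℓ) m) ⟩
      (S (suc ℓ) (suc m) + G m * S (suc ℓ) m) + a * S (2 ℕ.+ ℓ) (suc m)
        ≈⟨ +-assoc _ _ _ ⟩
      S (suc ℓ) (suc m) + (G m * S (suc ℓ) m + a * S (2 ℕ.+ ℓ) (suc m))
        ≈⟨ +-congˡ (exchange m) ⟩
      S (suc ℓ) (suc m) + (a * S (2 ℕ.+ ℓ) m + G m * S ℓ (suc m))
        ≈⟨ sym (+-assoc _ _ _) ⟩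
      (S (suc ℓ) (suc m) + a * S (2 ℕ.+ ℓ) m) + G m * S ℓ (suc m)
        ≈⟨ +-cong (sym (tilingSumFrom-bottom ℓ m)) (*-congʳ (powFib-cong (≡.sym (ℕₚ.+-suc ℓ m)))) ⟩
      S ℓ (2 ℕ.+ m) + pow R q (fib (ℓ ℕ.+ suc m)) * S ℓ (suc m) ∎
      where
      S = tilingSumFrom
      a = pow R q (fib ℓ)
      G : ℕ → Carrier
      G m = pow R q (fib (suc (ℓ ℕ.+ m)))
      exchange : ∀ m → G m * S (suc ℓ) m + a * S (2 ℕ.+ ℓ) (suc m) ≈ a * S (2 ℕ.+ ℓ) m + G m * S ℓ (suc m)
      exchange zero    = +-comm _ _
      exchange (suc m) = begin
        G (suc m) * S (suc ℓ) (suc m) + a * S (2 ℕ.+ ℓ) (2 ℕ.+ m)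
          ≈⟨ +-congˡ (*-congˡ (trans (tilingSumFrom-top (2 ℕ.+ ℓ) m)
               (+-congˡ (*-congʳ (powFib-cong (cong suc (≡.sym (ℕₚ.+-suc ℓ m)))))))) ⟩
        G (suc m) * S (suc ℓ) (suc m) + a * (S (2 ℕ.+ ℓ) (suc m) + G (suc m) * S (2 ℕ.+ ℓ) m)
          ≈⟨ solve 5 (λ g b a c d → g :* b :+ a :* (c :+ g :* d) := a :* c :+ g :* (b :+ a :* d))
               refl (G (suc m)) (S (suc ℓ) (suc m)) a (S (2 ℕ.+ ℓ) (suc m)) (S (2 ℕ.+ ℓ) m) ⟩
        a * S (2 ℕ.+ ℓ) (suc m) + G (suc m) * (S (suc ℓ) (suc m) + a * S (2 ℕ.+ ℓ) m)
          ≈⟨ +-congˡ (*-congˡ (sym (tilingSumFrom-bottom ℓ m))) ⟩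
        a * S (2 ℕ.+ ℓ) (suc m) + G (suc m) * S ℓ (2 ℕ.+ m) ∎

    tilingSumFrom-2 : ∀ m → tilingSumFrom 2 m ≈ qInt R q (fib (suc m))
    tilingSumFrom-2 zero          = qInt-1 q
    tilingSumFrom-2 (suc zero)    = qInt-1 q
    tilingSumFrom-2 (suc (suc m)) = begin
      tilingSumFrom 2 (2 ℕ.+ m)
        ≈⟨ tilingSumFrom-top 2 m ⟩
      tilingSumFrom 2 (suc m) + pow R q (fib (2 ℕ.+ m)) * tilingSumFrom 2 m
        ≈⟨ +-cong (tilingSumFrom-2 (suc m)) (*-congˡ (tilingSumFrom-2 m)) ⟩
      qInt R q (fib (2 ℕ.+ m)) + pow R q (fib (2 ℕ.+ m)) * qInt R q (fib (suc m))
        ≈⟨ sym (qInt-+ q (fib (2 ℕ.+ m)) (fib (suc m))) ⟩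
      qInt R q (fib (3 ℕ.+ m)) ∎

    fibTilingSum : ℕ → Carrier
    fibTilingSum e = Σ (map (pow R q ∘ rank) (fibTilings e))

    fibTilingSum≈qInt : ∀ e → fibTilingSum e ≈ qInt R q (fib e)
    fibTilingSum≈qInt zero    = refl
    fibTilingSum≈qInt (suc m) = trans (reflexive (cong Σ (≡.sym (map-∘ (allTilings m))))) (tilingSumFrom-2 m)

    module _ (bl : List ℕ) where

      weightOn : ℕ → List ℕ → Carrier
      weightOn s is = Σ (map (pow R q ∘ placementRank) (placementsOn bl s is))

      placementSum : ℕ → List ℕ → ℕ → Carrier
      placementSum s is k = Σ (map (weightOn s) (choose k is))

      weightOn-∷ : ∀ s i is → weightOn s (i ∷ is) ≈ fibTilingSum (col bl (i ∸ s ℕ.+ 1)) * weightOn (suc s) is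
      weightOn-∷ s i is = begin
        weightOn s (i ∷ is)
          ≈⟨ Σ-map-concatMap w (λ T → map ((i , T) ∷_) rest) tilings ⟩
        Σ (map (λ T → Σ (map w (map ((i , T) ∷_) rest))) tilings)
          ≈⟨ Σ-map-cong (λ T → trans (reflexive (cong Σ (≡.sym (map-∘ rest))))
                                (trans (Σ-map-cong (λ P → pow-+ q (rank T) (placementRank P)) rest)
                                       (Σ-map-*ˡ (pow R q (rank T)) w rest))) tilings ⟩
        Σ (map (λ T → pow R q (rank T) * weightOn (suc s) is) tilings)
          ≈⟨ Σ-map-*ʳ (weightOn (suc s) is) (pow R q ∘ rank) tilings ⟩
        fibTilingSum (col bl (i ∸ s ℕ.+ 1)) * weightOn (suc s) is ∎
        where
        w = pow R q ∘ placementRank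
        rest = placementsOn bl (suc s) is
        tilings = fibTilings (col bl (i ∸ s ℕ.+ 1))

      placementSum-zero : ∀ s is → placementSum s is 0 ≈ 1#
      placementSum-zero s is = trans (+-identityʳ _) (+-identityʳ _)

      placementSum-∷ : ∀ s i is k → placementSum s (i ∷ is) (suc k) ≈
        fibTilingSum (col bl (i ∸ s ℕ.+ 1)) * placementSum (suc s) is k + placementSum s is (suc k)
      placementSum-∷ s i is k = begin
        placementSum s (i ∷ is) (suc k)
          ≈⟨ Σ-map-++ (weightOn s) (map (i ∷_) (choose k is)) (choose (suc k) is) ⟩
        Σ (map (weightOn s) (map (i ∷_) (choose k is))) + placementSum s is (suc k)
          ≡⟨ cong (_+ placementSum s is (suc k)) (cong Σ (≡.sym (map-∘ (choose k is)))) ⟩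
        Σ (map (weightOn s ∘ (i ∷_)) (choose k is)) + placementSum s is (suc k)
          ≈⟨ +-congʳ (trans (Σ-map-cong (weightOn-∷ s i) (choose k is))
                            (Σ-map-*ˡ _ (weightOn (suc s)) (choose k is))) ⟩
        fibTilingSum (col bl (i ∸ s ℕ.+ 1)) * placementSum (suc s) is k + placementSum s is (suc k) ∎

      placementSum-short : ∀ s is k → length is < k → placementSum s is k ≈ 0#
      placementSum-short s is k |is|<k = reflexive (cong (Σ ∘ map (weightOn s)) (length<⇒choose≡[] is |is|<k))

      -- A tiling in column f t is weighted by z u, u the number of untiled columns to its left, so the
      -- placements of j tilings on j + k columns are the monomials of degree j in z 0, …, z k.
      placementSum≈completeHomogeneous : ∀ j k s (f : ℕ → ℕ) (z : ℕ → Carrier) →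
        (∀ t → f (suc t) ≡ suc (f t)) →
        (∀ t → fibTilingSum (col bl (f t ∸ s ℕ.+ 1)) ≈ z t) →
        placementSum s (applyUpTo f (j ℕ.+ k)) j ≈ completeHomogeneous z j (suc k)
      placementSum≈completeHomogeneous zero    k s f z f-suc f-z = placementSum-zero s (applyUpTo f k)
      placementSum≈completeHomogeneous (suc j) k s f z f-suc f-z = begin
        placementSum s (applyUpTo f (suc j ℕ.+ k)) (suc j)
          ≈⟨ placementSum-∷ s (f 0) (applyUpTo (f ∘ suc) (j ℕ.+ k)) j ⟩
        fibTilingSum (col bl (f 0 ∸ s ℕ.+ 1)) * placementSum (suc s) (applyUpTo (f ∘ suc) (j ℕ.+ k)) j
          + placementSum s (applyUpTo (f ∘ suc) (j ℕ.+ k)) (suc j)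
          ≈⟨ +-cong (*-cong (f-z 0) chosen) (skipped k) ⟩
        z 0 * completeHomogeneous z j (suc k) + completeHomogeneous (z ∘ suc) (suc j) k ∎
        where
        chosen : placementSum (suc s) (applyUpTo (f ∘ suc) (j ℕ.+ k)) j ≈ completeHomogeneous z j (suc k)
        chosen = placementSum≈completeHomogeneous j k (suc s) (f ∘ suc) z (f-suc ∘ suc)
          (λ t → trans (reflexive (cong (λ i → fibTilingSum (col bl (i ∸ suc s ℕ.+ 1))) (f-suc t))) (f-z t))
        skipped : ∀ k → placementSum s (applyUpTo (f ∘ suc) (j ℕ.+ k)) (suc j) ≈
                        completeHomogeneous (z ∘ suc) (suc j) k
        skipped zero    = placementSum-short s (applyUpTo (f ∘ suc) (j ℕ.+ 0)) (suc j)
          (s≤s (ℕₚ.≤-reflexive (≡.trans (length-applyUpTo (f ∘ suc) (j ℕ.+ 0)) (ℕₚ.+-identityʳ j))))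
        skipped (suc k) =
          trans (reflexive (cong (λ n → placementSum s (applyUpTo (f ∘ suc) n) (suc j)) (ℕₚ.+-suc j k)))
          (placementSum≈completeHomogeneous (suc j) k s (f ∘ suc) (z ∘ suc) (f-suc ∘ suc) (f-z ∘ suc))

    -- [F_{b_{t+1}}]_q; the weights are indexed from 0 as the variables of completeHomogeneous.
    fibWeight : List ℕ → ℕ → Carrier
    fibWeight bl t = qInt R q (fib (col bl (suc t)))

    RT≈completeHomogeneous : ∀ {n} (b : Vec ℕ n) j k → j ℕ.+ k ≡ n →
      RT R j b q ≈ completeHomogeneous (fibWeight (toList b)) j (suc k)
    RT≈completeHomogeneous {n} b j k ≡.refl = begin
      RT R j b q
        ≈⟨ Σ-map-concatMap (pow R q ∘ placementRank) (placementsOn bl 1) (choose j (columns n)) ⟩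
      placementSum bl 1 (columns n) j
        ≡⟨ cong (λ is → placementSum bl 1 is j) (map-upTo suc n) ⟩
      placementSum bl 1 (applyUpTo suc (j ℕ.+ k)) j
        ≈⟨ placementSum≈completeHomogeneous bl j k 1 suc (fibWeight bl) (λ _ → ≡.refl)
             (λ t → trans (fibTilingSum≈qInt (col bl (t ℕ.+ 1)))
                          (reflexive (cong (qInt R q ∘ fib ∘ col bl) (ℕₚ.+-comm t 1)))) ⟩
      completeHomogeneous (fibWeight bl) j (suc k) ∎
      where bl = toList b

theorem8 : {c ℓ : Level} (R : CommutativeRing c ℓ) (n : ℕ) (b : Vec ℕ n) →
    Nondecreasing b → 0 < col (toList b) n →
    (x : ℕ) → 0 < x → (q : CommutativeRing.Carrier R) →
    CommutativeRing._≈_ R (pow R (qInt R q x) n) (rhs R b x q)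
theorem8 R n b _ _ x _ q = sym (begin
  rhs R b x q
    ≈⟨ Σ-upTo≈antidiagonalSum R (λ j k → RT R j b q * fallingProd R k b x q) n ⟩
  antidiagonalSum R (λ j k → RT R j b q * fallingProd R k b x q) n
    ≈⟨ antidiagonalSum-cong R n (λ j k j+k≡n →
         *-cong (RT≈completeHomogeneous R q b j k j+k≡n) (reflexive (fallingProd≡newtonBasis k))) ⟩
  newtonSum R X z n
    ≈⟨ newtonSum≈pow R X z n ⟩
  pow R X n ∎)
  where
  open CommutativeRing R
  open import Relation.Binary.Reasoning.Setoid setoid
  X = qInt R q x
  z = fibWeight R q (toList b)
  fallingProd≡newtonBasis : ∀ k → fallingProd R k b x q ≡ newtonBasis R X z k
  fallingProd≡newtonBasis zero    = ≡.refl
  fallingProd≡newtonBasis (suc k) = cong (_* (X - z k)) (fallingProd≡newtonBasis k)
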